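{- Let $G=(V,E)$ be a graph, let $\omega:E\to\mathbb{Q}$ be an edge-weight function, and let $k$ be an integer. Let $\chi$ be a $c$-coloring of $G$ and let $v$ and $w$ be weighted twins in $G$ with $\chi(v)=\chi(w)$. If there is no improving $k$-neighbor $\chi'$ of $\chi$ with $v\in D_{\mathrm{flip}}(\chi,\chi')$, then there is no improving $k$-neighbor $\tilde\chi$ of $\chi$ with $w\in D_{\mathrm{flip}}(\chi,\tilde\chi)$.
   Context: Two vertices $v,w$ are weighted twins if $N(v)\setminus\{w\}=N(w)\setminus\{v\}$ and $\omega(\{v,x\})=\omega(\{w,x\})$ for each $x\in N(v)\setminus\{w\}$. A $c$-coloring is a map $V\to\{1,\dots,c\}$. $D_{\mathrm{flip}}(\chi,\chi')=\{u:\chi(u)\neq\chi'(u)\}$, $E(\chi)=\{\{u,x\}\in E:\chi(u)\neq\chi(x)\}$, and $\omega(F)$ is the total weight of $F$. $\chi'$ is an improving $k$-neighbor of $\chi$ if $|D_{\mathrm{flip}}(\chi,\chi')|\le k$ and $\omega(E(\chi'))>\omega(E(\chi))$. -}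

module Defs where

open import Data.Nat using (ℕ)
open import Data.Integer using (ℤ; +_) renaming (_≤_ to _≤ℤ_)
open import Data.Fin using (Fin)
open import Data.Fin.Properties using (_≟_; _<?_)
open import Data.Bool using (Bool; true; false; if_then_else_; _∧_; not)
open import Data.List using (List; []; _∷_; map; length; allFin; concatMap; filterᵇ)
open import Data.Product using (_×_; _,_; proj₁; proj₂)
open import Data.Rational using (ℚ; 0ℚ; _+_) renaming (_<_ to _<ℚ_)
open import Relation.Nullary using (does)
open import Relation.Binary.PropositionalEquality using (_≡_)

record Graph (n : ℕ) : Set where
  field
    adj     : Fin n → Fin n → Bool
    symm    : ∀ u x → adj u x ≡ adj x u
    irrefl  : ∀ u → adj u u ≡ false
open Graph public

-- Edge weights ω : E → ℚ, presented as a symmetric function on vertex pairs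
-- (only the values on edges {u,x} ∈ E are ever used).
record Weight (n : ℕ) : Set where
  field
    wt    : Fin n → Fin n → ℚ
    wsymm : ∀ u x → wt u x ≡ wt x u
open Weight public

Coloring : ℕ → ℕ → Set
Coloring n c = Fin n → Fin c

sumℚ : List ℚ → ℚ
sumℚ []       = 0ℚ
sumℚ (q ∷ qs) = q + sumℚ qs

edgeList : ∀ {n} → Graph n → List (Fin n × Fin n)
edgeList {n} G =
  filterᵇ (λ p → does (proj₁ p <? proj₂ p) ∧ adj G (proj₁ p) (proj₂ p))
          (concatMap (λ u → map (λ x → (u , x)) (allFin n)) (allFin n))

cutEdges : ∀ {n c} → Graph n → Coloring n c → List (Fin n × Fin n)
cutEdges G χ = filterᵇ (λ p → not (does (χ (proj₁ p) ≟ χ (proj₂ p)))) (edgeList G)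

cutWeight : ∀ {n c} → Graph n → Weight n → Coloring n c → ℚ
cutWeight G ω χ = sumℚ (map (λ p → wt ω (proj₁ p) (proj₂ p)) (cutEdges G χ))

Dflip : ∀ {n c} → Coloring n c → Coloring n c → List (Fin n)
Dflip {n} χ χ' = filterᵇ (λ u → not (does (χ u ≟ χ' u))) (allFin n)

InDflip : ∀ {n c} → Fin n → Coloring n c → Coloring n c → Set
InDflip u χ χ' = u ∈ Dflip χ χ'
  where open import Data.List.Membership.Propositional using (_∈_)

ImprovingNeighbor : ∀ {n c} → Graph n → Weight n → ℤ → Coloring n c → Coloring n c → Set
ImprovingNeighbor G ω k χ χ' =
  (+ length (Dflip χ χ') ≤ℤ k) × (cutWeight G ω χ <ℚ cutWeight G ω χ')

WeightedTwins : ∀ {n} → Graph n → Weight n → Fin n → Fin n → Set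
WeightedTwins {n} G ω v w =
  (∀ (x : Fin n) → (x ≡ v → ⊥) → (x ≡ w → ⊥) → adj G v x ≡ adj G w x) ×
  (∀ (x : Fin n) → (x ≡ w → ⊥) → adj G v x ≡ true → wt ω v x ≡ wt ω w x)
  where open import Data.Empty using (⊥)

-- The transposition σ = (v w) is an automorphism of the weighted graph,
-- so precomposing with σ preserves the cut weight ω(E(χ̃)).  Since
-- χ(v) = χ(w) we have χ ∘ σ = χ, so χ̃ ∘ σ flips exactly the vertices
-- σ(D_flip(χ,χ̃)): as many as χ̃ does, and v whenever χ̃ flips w.  Hence an
-- improving k-neighbour flipping w yields one flipping v.
module Submission where

open import Defs
open import Data.Nat using (ℕ)
open import Data.Integer using (ℤ)
open import Data.Fin using (Fin)
open import Data.Product using (_×_; ∃)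
open import Relation.Nullary using (¬_)
open import Relation.Binary.PropositionalEquality using (_≡_)

open import Algebra.Properties.CommutativeMonoid.Sum as MonoidSum using ()
open import Data.Bool using (Bool; true; false; if_then_else_; _∧_; not; T)
open import Data.Bool.Properties using (T?)
open import Data.Empty using (⊥-elim)
open import Data.Fin using (zero; suc)
open import Data.Fin.Permutation using (Permutation′; _⟨$⟩ʳ_; transpose)
open import Data.Fin.Permutation.Components as PC using ()
open import Data.Fin.Properties using (_≟_; _<?_; <-cmp)
open import Data.Integer as ℤ using ()
open import Data.List using (List; []; _∷_; map; length; allFin; concatMap; filterᵇ; tabulate; _++_)
open import Data.List.Membership.Propositional.Properties using (∈-filter⁺; ∈-filter⁻; ∈-allFin)
open import Data.List.Properties using (map-++; map-tabulate)
open import Data.Nat using (zero; suc)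
open import Data.Nat.Properties as ℕₚ using ()
open import Data.Product using (_,_; proj₁; proj₂)
open import Data.Rational using (ℚ; 0ℚ; _+_) renaming (_<_ to _<ℚ_)
open import Data.Rational.Properties as ℚₚ using ()
open import Data.Unit using (tt)
open import Function using (_∘_; id)
open import Relation.Binary using (tri<; tri≈; tri>)
open import Relation.Binary.PropositionalEquality
  using (refl; sym; trans; cong; cong₂; subst; _≢_; module ≡-Reasoning)
open import Relation.Nullary using (does; yes; no)
open import Relation.Nullary.Decidable using (dec-true; dec-false)

module Σℚ = MonoidSum ℚₚ.+-0-commutativeMonoid
module Σℕ = MonoidSum ℕₚ.+-0-commutativeMonoid

open ≡-Reasoning

x+x≡y+y⇒x≡y : ∀ {x y : ℚ} → x + x ≡ y + y → x ≡ y
x+x≡y+y⇒x≡y {x} {y} eq with ℚₚ.<-cmp x y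
... | tri< x<y _ _ = ⊥-elim (ℚₚ.<-irrefl eq (ℚₚ.+-mono-< x<y x<y))
... | tri≈ _ x≡y _ = x≡y
... | tri> _ _ y<x = ⊥-elim (ℚₚ.<-irrefl (sym eq) (ℚₚ.+-mono-< y<x y<x))

sumℚ-++ : (xs ys : List ℚ) → sumℚ (xs ++ ys) ≡ sumℚ xs + sumℚ ys
sumℚ-++ []       ys = sym (ℚₚ.+-identityˡ _)
sumℚ-++ (x ∷ xs) ys = trans (cong (x +_) (sumℚ-++ xs ys)) (sym (ℚₚ.+-assoc x _ _))

sumℚ-map-filterᵇ : ∀ {A : Set} (p : A → Bool) (f : A → ℚ) (xs : List A) →
  sumℚ (map f (filterᵇ p xs)) ≡ sumℚ (map (λ a → if p a then f a else 0ℚ) xs)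
sumℚ-map-filterᵇ p f [] = refl
sumℚ-map-filterᵇ p f (x ∷ xs) with p x
... | true  = cong (f x +_) (sumℚ-map-filterᵇ p f xs)
... | false = trans (sumℚ-map-filterᵇ p f xs) (sym (ℚₚ.+-identityˡ _))

sumℚ-map-concatMap : ∀ {A B : Set} (f : B → ℚ) (g : A → List B) (xs : List A) →
  sumℚ (map f (concatMap g xs)) ≡ sumℚ (map (λ a → sumℚ (map f (g a))) xs)
sumℚ-map-concatMap f g [] = refl
sumℚ-map-concatMap f g (x ∷ xs) = begin
  sumℚ (map f (g x ++ concatMap g xs))                  ≡⟨ cong sumℚ (map-++ f (g x) _) ⟩
  sumℚ (map f (g x) ++ map f (concatMap g xs))          ≡⟨ sumℚ-++ (map f (g x)) _ ⟩
  sumℚ (map f (g x)) + sumℚ (map f (concatMap g xs))    ≡⟨ cong (sumℚ (map f (g x)) +_) (sumℚ-map-concatMap f g xs) ⟩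
  sumℚ (map f (g x)) + sumℚ (map (λ a → sumℚ (map f (g a))) xs) ∎

sumℚ-tabulate : ∀ {n} (f : Fin n → ℚ) → sumℚ (tabulate f) ≡ Σℚ.sum f
sumℚ-tabulate {zero}  f = refl
sumℚ-tabulate {suc n} f = cong (f zero +_) (sumℚ-tabulate (f ∘ suc))

sumℚ-map-tabulate : ∀ {A : Set} {n} (f : A → ℚ) (g : Fin n → A) →
  sumℚ (map f (tabulate g)) ≡ Σℚ.sum (f ∘ g)
sumℚ-map-tabulate f g = trans (cong sumℚ (map-tabulate g f)) (sumℚ-tabulate (f ∘ g))

length-filterᵇ-tabulate : ∀ {A : Set} {n} (p : A → Bool) (f : Fin n → A) →
  length (filterᵇ p (tabulate f)) ≡ Σℕ.sum (λ i → if p (f i) then 1 else 0)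
length-filterᵇ-tabulate {n = zero} p f = refl
length-filterᵇ-tabulate {n = suc n} p f with p (f zero)
... | true  = cong suc (length-filterᵇ-tabulate p (f ∘ suc))
... | false = length-filterᵇ-tabulate p (f ∘ suc)

module _ {n c : ℕ} (G : Graph n) (ω : Weight n) (χ : Coloring n c) where

  crossingWeight : Fin n → Fin n → ℚ
  crossingWeight u x = if not (does (χ u ≟ χ x)) then wt ω u x else 0ℚ

  cutTerm : Fin n → Fin n → ℚ
  cutTerm u x = if adj G u x then crossingWeight u x else 0ℚ

  orderedCutTerm : Fin n → Fin n → ℚ
  orderedCutTerm u x = if does (u <? x) ∧ adj G u x then crossingWeight u x else 0ℚ

  cutWeight≡Σ-orderedCutTerm : cutWeight G ω χ ≡ Σℚ.sum (λ u → Σℚ.sum (orderedCutTerm u))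
  cutWeight≡Σ-orderedCutTerm = begin
    cutWeight G ω χ
      ≡⟨ sumℚ-map-filterᵇ _ _ (edgeList G) ⟩
    sumℚ (map (λ p → crossingWeight (proj₁ p) (proj₂ p)) (filterᵇ _ pairs))
      ≡⟨ sumℚ-map-filterᵇ _ _ pairs ⟩
    sumℚ (map ordered pairs)
      ≡⟨ sumℚ-map-concatMap _ _ (allFin n) ⟩
    sumℚ (map (λ u → sumℚ (map ordered (row u))) (allFin n))
      ≡⟨ sumℚ-map-tabulate {n = n} _ id ⟩
    Σℚ.sum (λ u → sumℚ (map ordered (row u)))
      ≡⟨ Σℚ.sum-cong-≗ (λ u → trans (cong (sumℚ ∘ map ordered) (map-tabulate id (u ,_)))
                                     (sumℚ-map-tabulate ordered (u ,_))) ⟩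
    Σℚ.sum (λ u → Σℚ.sum (orderedCutTerm u)) ∎
    where
    row : Fin n → List (Fin n × Fin n)
    row u = map (λ x → (u , x)) (allFin n)
    pairs : List (Fin n × Fin n)
    pairs = concatMap row (allFin n)
    ordered : Fin n × Fin n → ℚ
    ordered (u , x) = orderedCutTerm u x

  cutTerm-sym : ∀ u x → cutTerm u x ≡ cutTerm x u
  cutTerm-sym u x rewrite symm G u x | wsymm ω u x with χ u ≟ χ x | χ x ≟ χ u
  ... | yes _ | yes _ = refl
  ... | no _  | no _  = refl
  ... | yes p | no ¬q = ⊥-elim (¬q (sym p))
  ... | no ¬p | yes q = ⊥-elim (¬p (sym q))

  cutTerm≡orderedCutTerm+orderedCutTerm : ∀ u x → cutTerm u x ≡ orderedCutTerm u x + orderedCutTerm x u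
  cutTerm≡orderedCutTerm+orderedCutTerm u x with <-cmp u x
  ... | tri< u<x _ x≮u rewrite dec-true (u <? x) u<x | dec-false (x <? u) x≮u =
    sym (ℚₚ.+-identityʳ _)
  ... | tri> u≮x _ x<u rewrite dec-false (u <? x) u≮x | dec-true (x <? u) x<u =
    trans (cutTerm-sym u x) (sym (ℚₚ.+-identityˡ _))
  ... | tri≈ u≮x refl _ rewrite dec-false (u <? u) u≮x | irrefl G u = refl

  -- The symmetric double sum counts each cut edge twice, but unlike the edge list
  -- it is visibly invariant under relabelling the vertices.
  Σ-cutTerm≡cutWeight+cutWeight : Σℚ.sum (λ u → Σℚ.sum (cutTerm u)) ≡ cutWeight G ω χ + cutWeight G ω χ
  Σ-cutTerm≡cutWeight+cutWeight = begin
    Σℚ.sum (λ u → Σℚ.sum (cutTerm u))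
      ≡⟨ Σℚ.sum-cong-≗ (λ u → trans (Σℚ.sum-cong-≗ (cutTerm≡orderedCutTerm+orderedCutTerm u))
                                     (Σℚ.∑-distrib-+ (orderedCutTerm u) (λ x → orderedCutTerm x u))) ⟩
    Σℚ.sum (λ u → Σℚ.sum (orderedCutTerm u) + Σℚ.sum (λ x → orderedCutTerm x u))
      ≡⟨ Σℚ.∑-distrib-+ (Σℚ.sum ∘ orderedCutTerm) _ ⟩
    ΣΣ + Σℚ.sum (λ u → Σℚ.sum (λ x → orderedCutTerm x u))
      ≡⟨ cong (ΣΣ +_) (sym (Σℚ.∑-comm orderedCutTerm)) ⟩
    ΣΣ + ΣΣ
      ≡⟨ sym (cong₂ _+_ cutWeight≡Σ-orderedCutTerm cutWeight≡Σ-orderedCutTerm) ⟩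
    cutWeight G ω χ + cutWeight G ω χ ∎
    where
    ΣΣ : ℚ
    ΣΣ = Σℚ.sum (λ u → Σℚ.sum (orderedCutTerm u))

record IsAutomorphism {n} (G : Graph n) (ω : Weight n) (σ : Fin n → Fin n) : Set where
  field
    adj-preserved : ∀ u x → adj G (σ u) (σ x) ≡ adj G u x
    wt-preserved  : ∀ u x → adj G u x ≡ true → wt ω (σ u) (σ x) ≡ wt ω u x

module _ {n c : ℕ} {G : Graph n} {ω : Weight n} (π : Permutation′ n)
         (auto : IsAutomorphism G ω (π ⟨$⟩ʳ_)) where
  open IsAutomorphism auto

  private
    σ : Fin n → Fin n
    σ = π ⟨$⟩ʳ_

  cutTerm-∘ : (χ : Coloring n c) → ∀ u x → cutTerm G ω (χ ∘ σ) u x ≡ cutTerm G ω χ (σ u) (σ x)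
  cutTerm-∘ χ u x rewrite adj-preserved u x with adj G u x in e
  ... | false = refl
  ... | true rewrite wt-preserved u x e = refl

  cutWeight-∘ : (χ : Coloring n c) → cutWeight G ω (χ ∘ σ) ≡ cutWeight G ω χ
  cutWeight-∘ χ = x+x≡y+y⇒x≡y (begin
    cutWeight G ω (χ ∘ σ) + cutWeight G ω (χ ∘ σ)
      ≡⟨ sym (Σ-cutTerm≡cutWeight+cutWeight G ω (χ ∘ σ)) ⟩
    Σℚ.sum (λ u → Σℚ.sum (λ x → cutTerm G ω (χ ∘ σ) u x))
      ≡⟨ Σℚ.sum-cong-≗ (λ u → Σℚ.sum-cong-≗ (cutTerm-∘ χ u)) ⟩
    Σℚ.sum (λ u → Σℚ.sum (λ x → cutTerm G ω χ (σ u) (σ x)))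
      ≡⟨ Σℚ.sum-cong-≗ (λ u → sym (Σℚ.sum-permute (cutTerm G ω χ (σ u)) π)) ⟩
    Σℚ.sum (λ u → Σℚ.sum (cutTerm G ω χ (σ u)))
      ≡⟨ sym (Σℚ.sum-permute (λ u → Σℚ.sum (cutTerm G ω χ u)) π) ⟩
    Σℚ.sum (λ u → Σℚ.sum (cutTerm G ω χ u))
      ≡⟨ Σ-cutTerm≡cutWeight+cutWeight G ω χ ⟩
    cutWeight G ω χ + cutWeight G ω χ ∎)

InDflip⁺ : ∀ {n c} {u : Fin n} {χ χ' : Coloring n c} → χ u ≢ χ' u → InDflip u χ χ'
InDflip⁺ {u = u} {χ} {χ'} χu≢χ'u =
  ∈-filter⁺ (λ _ → T? _) (∈-allFin u) (subst (T ∘ not) (sym (dec-false (χ u ≟ χ' u) χu≢χ'u)) tt)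

InDflip⁻ : ∀ {n c} {u : Fin n} {χ χ' : Coloring n c} → InDflip u χ χ' → χ u ≢ χ' u
InDflip⁻ {n} {u = u} {χ} {χ'} u∈Dflip χu≡χ'u =
  subst (T ∘ not) (dec-true (χ u ≟ χ' u) χu≡χ'u) (proj₂ (∈-filter⁻ (λ _ → T? _) {xs = allFin n} u∈Dflip))

module _ {n c : ℕ} (π : Permutation′ n) {χ : Coloring n c}
         (χ∘π≗χ : ∀ u → χ (π ⟨$⟩ʳ u) ≡ χ u) (χ' : Coloring n c) where

  private
    σ : Fin n → Fin n
    σ = π ⟨$⟩ʳ_

    differs : Fin c → Fin c → ℕ
    differs a b = if not (does (a ≟ b)) then 1 else 0

  length-Dflip-∘ : length (Dflip χ (χ' ∘ σ)) ≡ length (Dflip χ χ')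
  length-Dflip-∘ = begin
    length (Dflip χ (χ' ∘ σ))                    ≡⟨ length-filterᵇ-tabulate {n = n} _ id ⟩
    Σℕ.sum (λ u → differs (χ u) (χ' (σ u)))       ≡⟨ Σℕ.sum-cong-≗ (λ u → cong (λ a → differs a (χ' (σ u))) (sym (χ∘π≗χ u))) ⟩
    Σℕ.sum (λ u → differs (χ (σ u)) (χ' (σ u)))   ≡⟨ sym (Σℕ.sum-permute (λ u → differs (χ u) (χ' u)) π) ⟩
    Σℕ.sum (λ u → differs (χ u) (χ' u))           ≡⟨ sym (length-filterᵇ-tabulate {n = n} _ id) ⟩
    length (Dflip χ χ')                          ∎

  InDflip-∘ : ∀ {u} → InDflip (σ u) χ χ' → InDflip u χ (χ' ∘ σ)
  InDflip-∘ {u} σu∈Dflip =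
    InDflip⁺ {χ = χ} {χ' ∘ σ} (InDflip⁻ {χ = χ} {χ'} σu∈Dflip ∘ trans (χ∘π≗χ u))

data TransposeView {n} (v w : Fin n) : Fin n → Fin n → Set where
  at-v      : TransposeView v w v w
  at-w      : TransposeView v w w v
  elsewhere : ∀ {u} → u ≢ v → u ≢ w → TransposeView v w u u

transpose-view : ∀ {n} (v w u : Fin n) → TransposeView v w u (PC.transpose v w u)
transpose-view v w u with u ≟ v
... | yes refl = at-v
... | no u≢v with u ≟ w
...   | yes refl = at-w
...   | no u≢w   = elsewhere u≢v u≢w

module _ {n} {G : Graph n} {ω : Weight n} {v w : Fin n} (twins : WeightedTwins G ω v w) where

  private
    adj-twin : ∀ x → x ≢ v → x ≢ w → adj G v x ≡ adj G w x
    adj-twin = proj₁ twins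

    wt-twin : ∀ x → x ≢ w → adj G v x ≡ true → wt ω v x ≡ wt ω w x
    wt-twin = proj₂ twins

    adj-view : ∀ {u x s t} → TransposeView v w u s → TransposeView v w x t → adj G s t ≡ adj G u x
    adj-view at-v at-v = trans (irrefl G w) (sym (irrefl G v))
    adj-view at-v at-w = symm G w v
    adj-view at-v (elsewhere x≢v x≢w) = sym (adj-twin _ x≢v x≢w)
    adj-view at-w at-v = symm G v w
    adj-view at-w at-w = trans (irrefl G v) (sym (irrefl G w))
    adj-view at-w (elsewhere x≢v x≢w) = adj-twin _ x≢v x≢w
    adj-view (elsewhere {u} u≢v u≢w) at-v = trans (symm G u w) (trans (sym (adj-twin u u≢v u≢w)) (symm G v u))
    adj-view (elsewhere {u} u≢v u≢w) at-w = trans (symm G u v) (trans (adj-twin u u≢v u≢w) (symm G w u))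
    adj-view (elsewhere _ _) (elsewhere _ _) = refl

    no-loop : ∀ {u} {A : Set} → adj G u u ≡ true → A
    no-loop {u} e with trans (sym (irrefl G u)) e
    ... | ()

    wt-view : ∀ {u x s t} → TransposeView v w u s → TransposeView v w x t →
              adj G u x ≡ true → wt ω s t ≡ wt ω u x
    wt-view at-v at-v e = no-loop e
    wt-view at-v at-w e = wsymm ω w v
    wt-view at-v (elsewhere _ x≢w) e = sym (wt-twin _ x≢w e)
    wt-view at-w at-v e = wsymm ω v w
    wt-view at-w at-w e = no-loop e
    wt-view at-w (elsewhere {x} x≢v x≢w) e = wt-twin x x≢w (trans (adj-twin x x≢v x≢w) e)
    wt-view (elsewhere {u} _ u≢w) at-v e =
      trans (wsymm ω u w) (trans (sym (wt-twin u u≢w (trans (symm G v u) e))) (wsymm ω v u))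
    wt-view (elsewhere {u} u≢v u≢w) at-w e =
      trans (wsymm ω u v) (trans (wt-twin u u≢w (trans (adj-twin u u≢v u≢w) (trans (symm G w u) e)))
                                 (wsymm ω w u))
    wt-view (elsewhere _ _) (elsewhere _ _) e = refl

  twins⇒transpose-isAutomorphism : IsAutomorphism G ω (transpose v w ⟨$⟩ʳ_)
  twins⇒transpose-isAutomorphism = record
    { adj-preserved = λ u x → adj-view (transpose-view v w u) (transpose-view v w x)
    ; wt-preserved  = λ u x → wt-view (transpose-view v w u) (transpose-view v w x)
    }

coloring∘transpose≗coloring : ∀ {n c} {v w : Fin n} {χ : Coloring n c} → χ v ≡ χ w →
                      ∀ u → χ (transpose v w ⟨$⟩ʳ u) ≡ χ u
coloring∘transpose≗coloring {v = v} {w} {χ} χv≡χw u = go (transpose-view v w u)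
  where
  go : ∀ {u s} → TransposeView v w u s → χ s ≡ χ u
  go at-v            = sym χv≡χw
  go at-w            = χv≡χw
  go (elsewhere _ _) = refl

transpose-mapsˡ : ∀ {n} (v w : Fin n) → transpose v w ⟨$⟩ʳ v ≡ w
transpose-mapsˡ v w rewrite dec-true (v ≟ v) refl = refl

ImprovingNeighbor-∘ : ∀ {n c} {G : Graph n} {ω : Weight n} {k : ℤ} {χ χ' : Coloring n c}
  (π : Permutation′ n) → IsAutomorphism G ω (π ⟨$⟩ʳ_) → (∀ u → χ (π ⟨$⟩ʳ u) ≡ χ u) →
  ImprovingNeighbor G ω k χ χ' → ImprovingNeighbor G ω k χ (χ' ∘ (π ⟨$⟩ʳ_))
ImprovingNeighbor-∘ {G = G} {ω} {k} {χ} {χ'} π auto χ∘π≗χ (fewFlips , improves) =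
    subst (λ l → ℤ.+ l ℤ.≤ k) (sym (length-Dflip-∘ π χ∘π≗χ χ')) fewFlips
  , subst (cutWeight G ω χ <ℚ_) (sym (cutWeight-∘ π auto χ')) improves

lemma5 : {n c : ℕ} (G : Graph n) (ω : Weight n) (k : ℤ) (χ : Coloring n c) (v w : Fin n) →
    WeightedTwins G ω v w → χ v ≡ χ w →
    ¬ (∃ λ (χ' : Coloring n c) → ImprovingNeighbor G ω k χ χ' × InDflip v χ χ') →
    ¬ (∃ λ (χ~ : Coloring n c) → ImprovingNeighbor G ω k χ χ~ × InDflip w χ χ~)
lemma5 G ω k χ v w twins χv≡χw noImprovingAtV (χ~ , improving , w∈Dflip) =
  noImprovingAtV
    ( χ~ ∘ (σ ⟨$⟩ʳ_)
    , ImprovingNeighbor-∘ {G = G} {ω} {k} σ (twins⇒transpose-isAutomorphism twins) χ∘σ≗χ improving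
    , InDflip-∘ σ χ∘σ≗χ χ~ (subst (λ u → InDflip u χ χ~) (sym (transpose-mapsˡ v w)) w∈Dflip) )
  where
  σ : Permutation′ _
  σ = transpose v w
  χ∘σ≗χ : ∀ u → χ (σ ⟨$⟩ʳ u) ≡ χ u
  χ∘σ≗χ = coloring∘transpose≗coloring χv≡χw
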